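{- Let $(\mathcal{C},\otimes,I)$ be a small productive semicartesian symmetric monoidal category (i.e. $I$ is terminal). Then the symmetric monoidal category $\mathrm{STREAM}$ of monoidal streams over $\mathcal{C}$ is semicartesian: its monoidal unit, the constant sequence $(I,I,\dots)$, is a terminal object.
   Context: Composition in diagrammatic order $;$, coherence isomorphisms suppressed. $\mathcal{C}^{\mathbb{N}}$: sequences $\mathbf{X}=(X_0,X_1,\dots)$ of objects; $\mathbf{X}^+=(X_1,X_2,\dots)$; $M\cdot\mathbf{X}=(M\otimes X_0,X_1,\dots)$. Productive: for objects $P,Q$ write $\langle h\rangle$ for the class of $h\colon P\to W\otimes Q$ in $\int^W\mathcal{C}(P,W\otimes Q)$ (morphisms with varying $W$ modulo the equivalence generated by $h;(r\otimes1_Q)\sim h$). $\mathcal{C}$ is productive if for all $X_0,Y_0$, every class $\alpha\in\int^M\mathcal{C}(X_0,M\otimes Y_0)$ admits $M_0$, $\alpha_0\colon X_0\to M_0\otimes Y_0$ and for each representative $\alpha_i\colon X_0\to M_i\otimes Y_0$ a morphism $s_i\colon M_0\to M_i$ with $\alpha_i=\alpha_0;(s_i\otimes1)$, such that for all $u\colon M_i\otimes A\to U\otimes B$, $v\colon M_j\otimes A\to V\otimes B$, $\langle(\alpha_i\otimes1_A);(u\otimes1_{Y_0})\rangle=\langle(\alpha_j\otimes1_A);(v\otimes1_{Y_0})\rangle$ implies $\langle(s_i\otimes1_A);u\rangle=\langle(s_j\otimes1_A);v\rangle$. Monoidal streams (for productive $\mathcal{C}$): $\mathrm{STREAM}(\mathbf{X},\mathbf{Y})$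 is the final coalgebra of $\Phi(Q)(\mathbf{X},\mathbf{Y})=\int^{M}\mathcal{C}(X_0,M\otimes Y_0)\times Q(M\cdot\mathbf{X}^+,\mathbf{Y}^+)$. Concretely a stream $f$ consists of a memory $M(f)\in\mathcal{C}$, a first action $\mathrm{now}(f)\colon X_0\to M(f)\otimes Y_0$ and a rest $\mathrm{later}(f)\in\mathrm{STREAM}(M(f)\cdot\mathbf{X}^+,\mathbf{Y}^+)$, quotiented (coinductively) by the equivalence generated by: $f\sim g$ if there is $r\colon M(g)\to M(f)$ with $\mathrm{now}(f)=\mathrm{now}(g);(r\otimes1)$ and $r\cdot\mathrm{later}(f)\sim\mathrm{later}(g)$, where $r\cdot h$ precomposes the first action of $h$ with $r\otimes1$. Composition with memories: for $f\in\mathrm{STREAM}(A\cdot\mathbf{X},\mathbf{Y})$, $g\in\mathrm{STREAM}(B\cdot\mathbf{Y},\mathbf{Z})$, $f^A;g^B\in\mathrm{STREAM}((A\otimes B)\cdot\mathbf{X},\mathbf{Z})$ has memory $M(f)\otimes M(g)$, first action $A\otimes B\otimes X_0\to M(f)\otimes M(g)\otimes Z_0$ given by $\mathrm{now}(f)$ followed by $\mathrm{now}(g)$ (with symmetries), and rest $\mathrm{later}(f)^{M(f)};\mathrm{later}(g)^{M(g)}$; $f;g:=f^I;g^I$. The identity has memory $I$, first action $\mathrm{id}_{X_0}$ and rest the identity on $\mathbf{X}^+$. The tensor $f\otimes g$ (defined analogously with memories) has memory $M(f)\otimes M(g)$, first action $\mathrm{now}(f)\otimes\mathrm{now}(g)$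 up to symmetries, and rest $\mathrm{later}(f)\otimes\mathrm{later}(g)$. This makes $\mathrm{STREAM}$ a symmetric monoidal category with the objects of $\mathcal{C}^{\mathbb{N}}$. -}

module Defs where

open import Level using (Level; _⊔_) renaming (suc to lsuc)
open import Data.Nat using (ℕ; zero; suc)
open import Data.Product using (Σ; _,_; proj₁; proj₂; _×_)
open import Relation.Binary.Core using (Rel)
open import Relation.Binary.Structures using (IsEquivalence)
open import Relation.Binary.Construct.Closure.Equivalence using (EqClosure)

record SymMonCat (o h e : Level) : Set (lsuc (o ⊔ h ⊔ e)) where
  infixr 9 _⨾_
  infixr 10 _⊗₀_ _⊗₁_
  infix  4 _≈_
  field
    Obj   : Set o
    Hom   : Obj → Obj → Set h
    _≈_   : ∀ {A B} → Rel (Hom A B) e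
    ≈-isEquivalence : ∀ {A B} → IsEquivalence (_≈_ {A} {B})
    id    : ∀ {A} → Hom A A
    _⨾_   : ∀ {A B C} → Hom A B → Hom B C → Hom A C
    ⨾-resp : ∀ {A B C} {f f′ : Hom A B} {g g′ : Hom B C} →
             f ≈ f′ → g ≈ g′ → f ⨾ g ≈ f′ ⨾ g′
    identityˡ : ∀ {A B} {f : Hom A B} → id ⨾ f ≈ f
    identityʳ : ∀ {A B} {f : Hom A B} → f ⨾ id ≈ f
    assoc     : ∀ {A B C D} {f : Hom A B} {g : Hom B C} {k : Hom C D} →
                (f ⨾ g) ⨾ k ≈ f ⨾ (g ⨾ k)
    _⊗₀_  : Obj → Obj → Obj
    _⊗₁_  : ∀ {A B C D} → Hom A B → Hom C D → Hom (A ⊗₀ C) (B ⊗₀ D)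
    ⊗-resp : ∀ {A B C D} {f f′ : Hom A B} {g g′ : Hom C D} →
             f ≈ f′ → g ≈ g′ → f ⊗₁ g ≈ f′ ⊗₁ g′
    ⊗-id   : ∀ {A C} → id {A} ⊗₁ id {C} ≈ id
    ⊗-⨾    : ∀ {A B C D E F} {f : Hom A B} {g : Hom B C} {k : Hom D E} {l : Hom E F} →
             (f ⨾ g) ⊗₁ (k ⨾ l) ≈ (f ⊗₁ k) ⨾ (g ⊗₁ l)
    unit   : Obj
    α⇒ : ∀ {A B C} → Hom ((A ⊗₀ B) ⊗₀ C) (A ⊗₀ (B ⊗₀ C))
    α⇐ : ∀ {A B C} → Hom (A ⊗₀ (B ⊗₀ C)) ((A ⊗₀ B) ⊗₀ C)
    α-isoˡ : ∀ {A B C} → α⇒ {A} {B} {C} ⨾ α⇐ ≈ id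
    α-isoʳ : ∀ {A B C} → α⇐ {A} {B} {C} ⨾ α⇒ ≈ id
    α-natural : ∀ {A B C D E F} {f : Hom A B} {g : Hom C D} {k : Hom E F} →
                ((f ⊗₁ g) ⊗₁ k) ⨾ α⇒ ≈ α⇒ ⨾ (f ⊗₁ (g ⊗₁ k))
    λ⇒ : ∀ {A} → Hom (unit ⊗₀ A) A
    λ⇐ : ∀ {A} → Hom A (unit ⊗₀ A)
    λ-isoˡ : ∀ {A} → λ⇒ {A} ⨾ λ⇐ ≈ id
    λ-isoʳ : ∀ {A} → λ⇐ {A} ⨾ λ⇒ ≈ id
    λ-natural : ∀ {A B} {f : Hom A B} → (id ⊗₁ f) ⨾ λ⇒ ≈ λ⇒ ⨾ f
    ρ⇒ : ∀ {A} → Hom (A ⊗₀ unit) A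
    ρ⇐ : ∀ {A} → Hom A (A ⊗₀ unit)
    ρ-isoˡ : ∀ {A} → ρ⇒ {A} ⨾ ρ⇐ ≈ id
    ρ-isoʳ : ∀ {A} → ρ⇐ {A} ⨾ ρ⇒ ≈ id
    ρ-natural : ∀ {A B} {f : Hom A B} → (f ⊗₁ id) ⨾ ρ⇒ ≈ ρ⇒ ⨾ f
    σ : ∀ {A B} → Hom (A ⊗₀ B) (B ⊗₀ A)
    σ-involutive : ∀ {A B} → σ {A} {B} ⨾ σ ≈ id
    σ-natural : ∀ {A B C D} {f : Hom A B} {g : Hom C D} →
                (f ⊗₁ g) ⨾ σ ≈ σ ⨾ (g ⊗₁ f)
    pentagon : ∀ {A B C D} →
               (α⇒ {A} {B} {C} ⊗₁ id {D}) ⨾ α⇒ ⨾ (id ⊗₁ α⇒) ≈ α⇒ ⨾ α⇒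
    triangle : ∀ {A B} → α⇒ {A} {unit} {B} ⨾ (id ⊗₁ λ⇒) ≈ ρ⇒ ⊗₁ id
    hexagon  : ∀ {A B C} →
               α⇒ {A} {B} {C} ⨾ σ ⨾ α⇒ ≈ (σ ⊗₁ id) ⨾ α⇒ ⨾ (id ⊗₁ σ)

record SemiCartesian {o h e} (C : SymMonCat o h e) : Set (o ⊔ h ⊔ e) where
  open SymMonCat C
  field
    ! : ∀ {A} → Hom A unit
    !-unique : ∀ {A} (f : Hom A unit) → f ≈ !

module _ {o h e} (C : SymMonCat o h e) where
  open SymMonCat C

  -- Coends  ∫^W C(P, W ⊗ Q): representatives (W , h) modulo the
  -- equivalence generated by  h ⨾ (r ⊗ 1_Q) ∼ h  (and by ≈ of morphisms).

  CoendRep : Obj → Obj → Set (o ⊔ h)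
  CoendRep P Q = Σ Obj (λ W → Hom P (W ⊗₀ Q))

  data CoendStep (P Q : Obj) : CoendRep P Q → CoendRep P Q → Set (o ⊔ h ⊔ e) where
    dinat : ∀ {V W} (r : Hom V W) (k : Hom P (V ⊗₀ Q)) →
            CoendStep P Q (W , k ⨾ (r ⊗₁ id)) (V , k)
    resp  : ∀ {W} {k k′ : Hom P (W ⊗₀ Q)} → k ≈ k′ →
            CoendStep P Q (W , k) (W , k′)

  CoendEq : ∀ {P Q} → CoendRep P Q → CoendRep P Q → Set (o ⊔ h ⊔ e)
  CoendEq {P} {Q} = EqClosure (CoendStep P Q)

  shuffle : ∀ {M Y A} → Hom ((M ⊗₀ Y) ⊗₀ A) ((M ⊗₀ A) ⊗₀ Y)
  shuffle = α⇒ ⨾ (id ⊗₁ σ) ⨾ α⇐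

  -- the morphism (αᵢ ⊗ 1_A) ; (u ⊗ 1_Y) : X ⊗ A → U ⊗ (B ⊗ Y)
  -- (with the suppressed coherence isomorphisms made explicit)
  extendRep : ∀ {X Y Mi A U B} → Hom X (Mi ⊗₀ Y) → Hom (Mi ⊗₀ A) (U ⊗₀ B) →
              Hom (X ⊗₀ A) (U ⊗₀ (B ⊗₀ Y))
  extendRep ai u = (ai ⊗₁ id) ⨾ shuffle ⨾ (u ⊗₁ id) ⨾ α⇒

  record ProductiveAt (X₀ Y₀ : Obj) (a : CoendRep X₀ Y₀) : Set (o ⊔ h ⊔ e) where
    field
      M₀ : Obj
      α₀ : Hom X₀ (M₀ ⊗₀ Y₀)
      -- for each representative αᵢ of the class a, a morphism sᵢ
      -- (depending only on the representative, not on the proof)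
      s  : (i : CoendRep X₀ Y₀) → .(CoendEq i a) → Hom M₀ (proj₁ i)
      s-factor : (i : CoendRep X₀ Y₀) (p : CoendEq i a) →
                 proj₂ i ≈ α₀ ⨾ (s i p ⊗₁ id)
      s-universal :
        (i j : CoendRep X₀ Y₀) (p : CoendEq i a) (q : CoendEq j a)
        {A U V B : Obj}
        (u : Hom (proj₁ i ⊗₀ A) (U ⊗₀ B)) (v : Hom (proj₁ j ⊗₀ A) (V ⊗₀ B)) →
        CoendEq {X₀ ⊗₀ A} {B ⊗₀ Y₀} (U , extendRep (proj₂ i) u) (V , extendRep (proj₂ j) v) →
        CoendEq {M₀ ⊗₀ A} {B} (U , (s i p ⊗₁ id) ⨾ u) (V , (s j q ⊗₁ id) ⨾ v)

  Productive : Set (o ⊔ h ⊔ e)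
  Productive = (X₀ Y₀ : Obj) (a : CoendRep X₀ Y₀) → ProductiveAt X₀ Y₀ a

  Seq : Set o
  Seq = ℕ → Obj

  tail : Seq → Seq
  tail X n = X (suc n)

  _·_ : Obj → Seq → Seq
  (M · X) zero    = M ⊗₀ X zero
  (M · X) (suc n) = X (suc n)

  constSeq : Obj → Seq
  constSeq A _ = A

  -- Intensional monoidal streams: elements of the final coalgebra of
  --   Q(X,Y) ↦ Σ_M C(X₀, M ⊗ Y₀) × Q(M · X⁺, Y⁺)
  -- presented by unfolding: memories mem n and actions
  --   act 0       : X₀ → mem 0 ⊗ Y₀
  --   act (n + 1) : mem n ⊗ X (n+1) → mem (n+1) ⊗ Y (n+1).

  input : Seq → (ℕ → Obj) → ℕ → Obj
  input X mem zero    = X zero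
  input X mem (suc n) = mem n ⊗₀ X (suc n)

  record Stream (X Y : Seq) : Set (o ⊔ h) where
    constructor mkStream
    field
      mem : ℕ → Obj
      act : (n : ℕ) → Hom (input X mem n) (mem n ⊗₀ Y n)

  open Stream

  Mem : ∀ {X Y} → Stream X Y → Obj
  Mem f = mem f zero

  now : ∀ {X Y} (f : Stream X Y) → Hom (X zero) (Mem f ⊗₀ Y zero)
  now f = act f zero

  later : ∀ {X Y} (f : Stream X Y) → Stream (Mem f · tail X) (tail Y)
  later {X} {Y} f = mkStream (λ n → mem f (suc n)) act′
    where
      act′ : (n : ℕ) → Hom (input (Mem f · tail X) (λ k → mem f (suc k)) n)
                           (mem f (suc n) ⊗₀ Y (suc n))
      act′ zero    = act f (suc zero)
      act′ (suc n) = act f (suc (suc n))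

  _▹_ : ∀ {M M′ X Y} → Hom M′ M → Stream (M · X) Y → Stream (M′ · X) Y
  _▹_ {M} {M′} {X} {Y} r f = mkStream (mem f) act′
    where
      act′ : (n : ℕ) → Hom (input (M′ · X) (mem f) n) (mem f n ⊗₀ Y n)
      act′ zero    = (r ⊗₁ id) ⨾ act f zero
      act′ (suc n) = act f (suc n)

  -- Equivalence of streams: the greatest relation ~ such that ~ is
  -- contained in the equivalence closure of
  --   f ≈₁ g  :⇔  ∃ r : M(g) → M(f).  now f ≈ now g ⨾ (r ⊗ 1)  ∧  (r · later f) ~ later g.
  -- Defined as the union of all post-fixed points (bisimulations).

  StreamRel : (ℓ : Level) → Set (o ⊔ h ⊔ lsuc ℓ)
  StreamRel ℓ = ∀ {X Y} → Stream X Y → Stream X Y → Set ℓ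

  Step : ∀ {ℓ} → StreamRel ℓ → ∀ {X Y} → Stream X Y → Stream X Y → Set (h ⊔ e ⊔ ℓ)
  Step R {X} {Y} f g =
    Σ (Hom (Mem g) (Mem f)) λ r →
      (now f ≈ now g ⨾ (r ⊗₁ id)) × R (r ▹ later f) (later g)

  IsBisimulation : ∀ {ℓ} → StreamRel ℓ → Set (o ⊔ h ⊔ e ⊔ ℓ)
  IsBisimulation R = ∀ {X Y} {f g : Stream X Y} → R f g → EqClosure (Step R) f g

  infix 4 _∼_
  _∼_ : ∀ {X Y} → Stream X Y → Stream X Y → Set (lsuc (o ⊔ h ⊔ e))
  f ∼ g = Σ (StreamRel (o ⊔ h ⊔ e)) λ R → IsBisimulation R × R f g

  -- T is a terminal object of STREAM (hom-sets are streams modulo ∼).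

  IsTerminalSTREAM : Seq → Set (lsuc (o ⊔ h ⊔ e))
  IsTerminalSTREAM T = (X : Seq) → Σ (Stream X T) λ t → (f : Stream X T) → f ∼ t

-- The constant stream discard with memories I and all actions the unique maps into I ⊗ I
-- is related to every stream f into (I, I, …) by a single step of ∼: take r = ! : M(f) → I;
-- the first actions agree because I ⊗ I ≅ I is terminal, and the rests are again streams
-- into (I, I, …). Hence "having codomain (I, I, …)" is a bisimulation, in which any two
-- streams are joined through discard.
module Submission where

open import Level using (Level; Lift; lift; _⊔_)
open import Data.Product using (_,_)
open import Relation.Binary.PropositionalEquality using (_≡_; refl)
open import Relation.Binary.Bundles using (Setoid)
open import Relation.Binary.Structures using (IsEquivalence)
open import Relation.Binary.Construct.Closure.Symmetric using (fwd; bwd)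
open import Relation.Binary.Construct.Closure.ReflexiveTransitive using (ε; _◅_)
import Relation.Binary.Reasoning.Setoid as SetoidReasoning
open import Defs

module _ {o h e : Level} (C : SymMonCat o h e) (SC : SemiCartesian C) where
  open SymMonCat C
  open SemiCartesian SC

  module ≈ {A B} = IsEquivalence (≈-isEquivalence {A} {B})

  hom-setoid : Obj → Obj → Setoid h e
  hom-setoid A B = record { isEquivalence = ≈-isEquivalence {A} {B} }

  unit⊗unit-terminal : ∀ {A} (k k′ : Hom A (unit ⊗₀ unit)) → k ≈ k′
  unit⊗unit-terminal {A} k k′ = begin
    k                  ≈⟨ unfold k ⟩
    (k ⨾ λ⇒) ⨾ λ⇐     ≈⟨ ⨾-resp (!-unique _) ≈.refl ⟩
    ! ⨾ λ⇐            ≈⟨ ⨾-resp (!-unique _) ≈.refl ⟨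
    (k′ ⨾ λ⇒) ⨾ λ⇐    ≈⟨ unfold k′ ⟨
    k′                 ∎
    where
      open SetoidReasoning (hom-setoid A (unit ⊗₀ unit))
      unfold : (l : Hom A (unit ⊗₀ unit)) → l ≈ (l ⨾ λ⇒) ⨾ λ⇐
      unfold l = begin
        l                ≈⟨ identityʳ ⟨
        l ⨾ id           ≈⟨ ⨾-resp ≈.refl λ-isoˡ ⟨
        l ⨾ (λ⇒ ⨾ λ⇐)   ≈⟨ assoc ⟨
        (l ⨾ λ⇒) ⨾ λ⇐   ∎

  unitSeq : Seq C
  unitSeq = constSeq C unit

  discard : (X : Seq C) → Stream C X unitSeq
  discard X = mkStream (λ _ → unit) (λ _ → ! ⨾ λ⇐)

  HasUnitCodomain : StreamRel C (o ⊔ h ⊔ e)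
  HasUnitCodomain {Y = Y} _ _ = Lift (h ⊔ e) (Y ≡ unitSeq)

  discard-step : ∀ {X} (f : Stream C X unitSeq) → Step C HasUnitCodomain (discard X) f
  discard-step f = ! , unit⊗unit-terminal _ _ , lift refl

  hasUnitCodomain-isBisimulation : IsBisimulation C HasUnitCodomain
  hasUnitCodomain-isBisimulation {X} {f = f} {g} (lift refl) =
    _◅_ {j = discard X} (bwd (discard-step f)) (fwd (discard-step g) ◅ ε)

  unitSeq-terminal : IsTerminalSTREAM C unitSeq
  unitSeq-terminal X = discard X , λ f → HasUnitCodomain , hasUnitCodomain-isBisimulation , lift refl

-- Productivity is what makes STREAM a category in the paper; terminality does not use it.
proposition7p13 : ∀ {o h e : Level} (C : SymMonCat o h e) →
    Productive C → SemiCartesian C →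
    IsTerminalSTREAM C (constSeq C (SymMonCat.unit C))
proposition7p13 C _ SC = unitSeq-terminal C SC
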